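{- For every $n \geq 2$, the complete graph $K_n$ admits a $2$-labelling $\ell$ such that, writing $S_x = \{v : \rho_\ell(v) = x\}$, there is exactly one value $x$ for which $K_n[S_x]$ consists of a single edge (i.e., $|S_x| = 2$), while $S_y$ is an independent set (i.e., $|S_y| \leq 1$) for every other $y$.
   Context: A $2$-labelling of a graph $G$ is a map $\ell: E(G) \to \{1,2\}$. For a vertex $v$, $\rho_\ell(v)$ denotes the product of the labels $\ell(uv)$ over all edges $uv$ incident to $v$. -}

module Defs where

open import Data.Nat using (ℕ; _*_; _+_)
open import Data.Fin using (Fin; _≟_)
open import Data.List using (List; map; filter; length)
open import Data.Nat.ListAction using (product)
open import Data.List.Base using (allFin)
open import Data.Nat.Properties using () renaming (_≟_ to _≟ℕ_)
open import Relation.Nullary using (¬_; Dec; ¬?)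
open import Relation.Binary.PropositionalEquality using (_≡_)

data Label : Set where
  one two : Label

val : Label → ℕ
val one = 1
val two = 2

-- A 2-labelling of K_n: vertices are Fin n, an edge {u,v} (u ≢ v) gets
-- label ℓ u v; we require symmetry so that this is a map on unordered edges.
-- (Values on the diagonal ℓ v v are never used.)
record TwoLabelling (n : ℕ) : Set where
  field
    lab : Fin n → Fin n → Label
    sym : ∀ u v → lab u v ≡ lab v u
open TwoLabelling public

ρ : ∀ {n} → TwoLabelling n → Fin n → ℕ
ρ {n} ℓ v = product (map (λ u → val (lab ℓ u v)) (filter (λ u → ¬? (u ≟ v)) (allFin n)))

classSize : ∀ {n} → TwoLabelling n → ℕ → ℕ
classSize {n} ℓ x = length (filter (λ v → ρ ℓ v ≟ℕ x) (allFin n))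

-- Build K_{k+2} two vertices at a time: first add a vertex joined to everything
-- by label 1, then one joined to everything by label 2.  This doubles every old
-- product, gives the first new vertex the product 2 and the second 2^(n+1).
-- All products of K_n lie in [2, 2^n), so the doubled old products lie in
-- [4, 2^(n+1)) and the two new values are fresh; doubling is injective, so the
-- unique repeated value of K_n (doubled) stays the unique repeated value.
module Submission where

open import Defs hiding (sym)
open import Data.Nat using (ℕ; zero; suc; _*_; _^_; _≤_; _<_; _≥_; z≤n; s≤s)
open import Data.Nat.Properties
  using (≤-refl; ≤-trans; <-trans; <-≤-trans; <-irrefl; <⇒≢; <⇒≱; *-cancelˡ-≡;
         *-monoʳ-≤; *-monoʳ-<; *-identityˡ; ^-zeroˡ; ^-monoʳ-≤; ^-monoʳ-<; n<1+n)
  renaming (_≟_ to _≟ℕ_)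
open import Data.Nat.ListAction using (product)
open import Data.Fin using (Fin; zero; suc; _≟_)
open import Data.List using (List; []; _∷_; map; filter; length)
open import Data.List.Base using (allFin)
open import Data.List.Properties using (map-tabulate; map-∘; map-cong; map-id; length-tabulate; filter-accept; filter-reject)
open import Data.List.Relation.Unary.All as All using (All; []; _∷_)
open import Data.List.Relation.Unary.All.Properties using (map⁺)
open import Data.List.Relation.Unary.Any using (here; there)
open import Data.List.Membership.Propositional using (_∉_)
open import Data.List.Membership.Propositional.Properties using (∈-map⁻)
open import Data.List.Membership.DecPropositional _≟ℕ_ using (_∈?_)
open import Data.Bool using (true; false)
open import Data.Product using (Σ; _×_; _,_; proj₂; uncurry)
open import Function using (_∘_; id)
open import Function.Definitions using (Injective)
open import Relation.Nullary using (¬_; ¬?; Dec; yes; no; does)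
open import Relation.Unary using (Decidable)
open import Relation.Binary.PropositionalEquality using (_≡_; _≢_; refl; sym; trans; cong; cong₂; subst)
open Relation.Binary.PropositionalEquality.≡-Reasoning

length-filter-∘ : {A B : Set} {P : B → Set} (P? : Decidable P) (f : A → B) (xs : List A) →
                  length (filter (P? ∘ f) xs) ≡ length (filter P? (map f xs))
length-filter-∘ P? f [] = refl
length-filter-∘ P? f (x ∷ xs) with does (P? (f x))
... | true  = cong suc (length-filter-∘ P? f xs)
... | false = length-filter-∘ P? f xs

multiplicity : ℕ → List ℕ → ℕ
multiplicity y xs = length (filter (_≟ℕ y) xs)

multiplicity-head : ∀ y xs → multiplicity y (y ∷ xs) ≡ suc (multiplicity y xs)
multiplicity-head y xs = cong length (filter-accept (_≟ℕ y) refl)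

multiplicity-tail : ∀ {x y} xs → x ≢ y → multiplicity y (x ∷ xs) ≡ multiplicity y xs
multiplicity-tail xs x≢y = cong length (filter-reject (_≟ℕ _) x≢y)

multiplicity-∉ : ∀ {y} xs → y ∉ xs → multiplicity y xs ≡ 0
multiplicity-∉ [] y∉ = refl
multiplicity-∉ (x ∷ xs) y∉ = trans (multiplicity-tail xs (λ x≡y → y∉ (here (sym x≡y))))
                                   (multiplicity-∉ xs (y∉ ∘ there))

multiplicity-map : ∀ {f : ℕ → ℕ} → Injective _≡_ _≡_ f →
                   ∀ y xs → multiplicity (f y) (map f xs) ≡ multiplicity y xs
multiplicity-map f-inj y [] = refl
multiplicity-map {f} f-inj y (x ∷ xs) = by-cases (x ≟ℕ y)
  where
  by-cases : Dec (x ≡ y) → multiplicity (f y) (map f (x ∷ xs)) ≡ multiplicity y (x ∷ xs)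
  by-cases (yes refl) = begin
    multiplicity (f x) (f x ∷ map f xs)   ≡⟨ multiplicity-head (f x) (map f xs) ⟩
    suc (multiplicity (f x) (map f xs))   ≡⟨ cong suc (multiplicity-map f-inj x xs) ⟩
    suc (multiplicity x xs)               ≡⟨ multiplicity-head x xs ⟨
    multiplicity x (x ∷ xs)               ∎
  by-cases (no x≢y) = begin
    multiplicity (f y) (f x ∷ map f xs)   ≡⟨ multiplicity-tail (map f xs) (x≢y ∘ f-inj) ⟩
    multiplicity (f y) (map f xs)         ≡⟨ multiplicity-map f-inj y xs ⟩
    multiplicity y xs                     ≡⟨ multiplicity-tail xs x≢y ⟨
    multiplicity y (x ∷ xs)               ∎

ExactlyOneRepeated : List ℕ → Set
ExactlyOneRepeated xs =
  Σ ℕ λ x → (multiplicity x xs ≡ 2) × ((y : ℕ) → y ≢ x → multiplicity y xs ≤ 1)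

exactlyOneRepeated-∷ : ∀ {a xs} → a ∉ xs → ExactlyOneRepeated xs → ExactlyOneRepeated (a ∷ xs)
exactlyOneRepeated-∷ {a} {xs} a∉xs (x , twice , others) = x , twice′ , others′
  where
  a≢x : a ≢ x
  a≢x refl with () ← trans (sym twice) (multiplicity-∉ xs a∉xs)

  twice′ : multiplicity x (a ∷ xs) ≡ 2
  twice′ = trans (multiplicity-tail xs a≢x) twice

  others′ : (y : ℕ) → y ≢ x → multiplicity y (a ∷ xs) ≤ 1
  others′ y y≢x with a ≟ℕ y
  ... | yes refl = subst (_≤ 1) (sym (trans (multiplicity-head a xs) (cong suc (multiplicity-∉ xs a∉xs)))) ≤-refl
  ... | no a≢y   = subst (_≤ 1) (sym (multiplicity-tail xs a≢y)) (others y y≢x)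

exactlyOneRepeated-map : ∀ {f : ℕ → ℕ} {xs} → Injective _≡_ _≡_ f →
                         ExactlyOneRepeated xs → ExactlyOneRepeated (map f xs)
exactlyOneRepeated-map {f} {xs} f-inj (x , twice , others) = f x , twice′ , others′
  where
  twice′ : multiplicity (f x) (map f xs) ≡ 2
  twice′ = trans (multiplicity-map f-inj x xs) twice

  others′ : (y : ℕ) → y ≢ f x → multiplicity y (map f xs) ≤ 1
  others′ y y≢fx with y ∈? map f xs
  ... | no y∉ = subst (_≤ 1) (sym (multiplicity-∉ (map f xs) y∉)) z≤n
  ... | yes y∈ with ∈-map⁻ f y∈
  ...   | z , _ , refl = subst (_≤ 1) (sym (multiplicity-map f-inj z xs)) (others z (y≢fx ∘ cong f))

constant : ∀ {n} → Label → TwoLabelling n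
constant c = record { lab = λ _ _ → c ; sym = λ _ _ → refl }

apex : ∀ {n} → Label → TwoLabelling n → TwoLabelling (suc n)
apex {n} c ℓ = record { lab = L ; sym = L-sym }
  where
  L : Fin (suc n) → Fin (suc n) → Label
  L zero    zero    = one
  L zero    (suc v) = c
  L (suc u) zero    = c
  L (suc u) (suc v) = lab ℓ u v

  L-sym : ∀ u v → L u v ≡ L v u
  L-sym zero    zero    = refl
  L-sym zero    (suc v) = refl
  L-sym (suc u) zero    = refl
  L-sym (suc u) (suc v) = TwoLabelling.sym ℓ u v

ρ-on : ∀ {n} → TwoLabelling n → List (Fin n) → Fin n → ℕ
ρ-on ℓ us v = product (map (λ u → val (lab ℓ u v)) (filter (λ u → ¬? (u ≟ v)) us))

allFin-suc : ∀ n → allFin (suc n) ≡ zero ∷ map suc (allFin n)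
allFin-suc n = cong (zero ∷_) (sym (map-tabulate id suc))

module _ {n} (c : Label) (ℓ : TwoLabelling n) where

  ρ-on-apex-zero : (us : List (Fin n)) → ρ-on (apex c ℓ) (map suc us) zero ≡ val c ^ length us
  ρ-on-apex-zero []       = refl
  ρ-on-apex-zero (u ∷ us) = cong (val c *_) (ρ-on-apex-zero us)

  ρ-on-apex-suc : ∀ v (us : List (Fin n)) → ρ-on (apex c ℓ) (map suc us) (suc v) ≡ ρ-on ℓ us v
  ρ-on-apex-suc v []       = refl
  ρ-on-apex-suc v (u ∷ us) with u ≟ v
  ... | yes _ = ρ-on-apex-suc v us
  ... | no _  = cong (val (lab ℓ u v) *_) (ρ-on-apex-suc v us)

  ρ-apex-zero : ρ (apex c ℓ) zero ≡ val c ^ n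
  ρ-apex-zero = begin
    ρ (apex c ℓ) zero                             ≡⟨ cong (λ us → ρ-on (apex c ℓ) us zero) (allFin-suc n) ⟩
    ρ-on (apex c ℓ) (map suc (allFin n)) zero     ≡⟨ ρ-on-apex-zero (allFin n) ⟩
    val c ^ length (allFin n)                     ≡⟨ cong (val c ^_) (length-tabulate {n = n} id) ⟩
    val c ^ n                                     ∎

  ρ-apex-suc : ∀ v → ρ (apex c ℓ) (suc v) ≡ val c * ρ ℓ v
  ρ-apex-suc v = begin
    ρ (apex c ℓ) (suc v)
      ≡⟨ cong (λ us → ρ-on (apex c ℓ) us (suc v)) (allFin-suc n) ⟩
    val c * ρ-on (apex c ℓ) (map suc (allFin n)) (suc v)
      ≡⟨ cong (val c *_) (ρ-on-apex-suc v (allFin n)) ⟩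
    val c * ρ ℓ v
      ∎

ρ-values : ∀ {n} → TwoLabelling n → List ℕ
ρ-values {n} ℓ = map (ρ ℓ) (allFin n)

ρ-values-apex : ∀ {n} c (ℓ : TwoLabelling n) →
                ρ-values (apex c ℓ) ≡ val c ^ n ∷ map (val c *_) (ρ-values ℓ)
ρ-values-apex {n} c ℓ = begin
  map (ρ (apex c ℓ)) (allFin (suc n))               ≡⟨ cong (map (ρ (apex c ℓ))) (allFin-suc n) ⟩
  ρ (apex c ℓ) zero ∷ map (ρ (apex c ℓ)) (map suc (allFin n))
    ≡⟨ cong₂ _∷_ (ρ-apex-zero c ℓ) (sym (map-∘ (allFin n))) ⟩
  val c ^ n ∷ map (ρ (apex c ℓ) ∘ suc) (allFin n)   ≡⟨ cong (val c ^ n ∷_) (map-cong (ρ-apex-suc c ℓ) (allFin n)) ⟩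
  val c ^ n ∷ map ((val c *_) ∘ ρ ℓ) (allFin n)     ≡⟨ cong (val c ^ n ∷_) (map-∘ (allFin n)) ⟩
  val c ^ n ∷ map (val c *_) (ρ-values ℓ)           ∎

ρ-values-apex-two-one : ∀ {n} (ℓ : TwoLabelling n) →
  ρ-values (apex two (apex one ℓ)) ≡ 2 ^ suc n ∷ 2 ∷ map (2 *_) (ρ-values ℓ)
ρ-values-apex-two-one {n} ℓ = begin
  ρ-values (apex two (apex one ℓ))                   ≡⟨ ρ-values-apex two (apex one ℓ) ⟩
  2 ^ suc n ∷ map (2 *_) (ρ-values (apex one ℓ))     ≡⟨ cong (λ xs → 2 ^ suc n ∷ map (2 *_) xs) (ρ-values-apex one ℓ) ⟩
  2 ^ suc n ∷ map (2 *_) (1 ^ n ∷ map (1 *_) (ρ-values ℓ))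
    ≡⟨ cong (λ xs → 2 ^ suc n ∷ map (2 *_) xs) (cong₂ _∷_ (^-zeroˡ n) (map-cong *-identityˡ (ρ-values ℓ))) ⟩
  2 ^ suc n ∷ 2 ∷ map (2 *_) (map id (ρ-values ℓ))   ≡⟨ cong (λ xs → 2 ^ suc n ∷ 2 ∷ map (2 *_) xs) (map-id (ρ-values ℓ)) ⟩
  2 ^ suc n ∷ 2 ∷ map (2 *_) (ρ-values ℓ)            ∎

classSize≡multiplicity : ∀ {n} (ℓ : TwoLabelling n) x → classSize ℓ x ≡ multiplicity x (ρ-values ℓ)
classSize≡multiplicity {n} ℓ x = length-filter-∘ (_≟ℕ x) (ρ ℓ) (allFin n)

labelling : (k : ℕ) → TwoLabelling (suc (suc k))
labelling zero          = constant two
labelling (suc zero)    = apex two (constant one)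
labelling (suc (suc k)) = apex two (apex one (labelling k))

InRange : ℕ → List ℕ → Set
InRange n = All (λ r → 2 ≤ r × r < 2 ^ n)

private
  2≤4 : 2 ≤ 4
  2≤4 = s≤s (s≤s z≤n)

  2<4 : 2 < 4
  2<4 = s≤s (s≤s (s≤s z≤n))

doubling-injective : Injective _≡_ _≡_ (2 *_)
doubling-injective {x} {y} = *-cancelˡ-≡ x y 2

doubling-step : ∀ n {xs} → InRange (suc n) xs → ExactlyOneRepeated xs →
       let ys = 2 ^ suc (suc n) ∷ 2 ∷ map (2 *_) xs in
       InRange (suc (suc (suc n))) ys × ExactlyOneRepeated ys
doubling-step n {xs} range repeated =
  (top-range ∷ two-range ∷ doubled-range) ,
  exactlyOneRepeated-∷ top-fresh
    (exactlyOneRepeated-∷ two-fresh (exactlyOneRepeated-map {xs = xs} doubling-injective repeated))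
  where
  top = 2 ^ suc (suc n)

  4≤top : 4 ≤ top
  4≤top = ^-monoʳ-≤ 2 {2} {suc (suc n)} (s≤s (s≤s z≤n))

  top<2*top : top < 2 * top
  top<2*top = ^-monoʳ-< 2 ≤-refl (n<1+n (suc (suc n)))

  doubled : All (λ r → 4 ≤ r × r < top) (map (2 *_) xs)
  doubled = map⁺ (All.map (λ (2≤r , r<2^[1+n]) → *-monoʳ-≤ 2 2≤r , *-monoʳ-< 2 r<2^[1+n]) range)

  top-range : 2 ≤ top × top < 2 * top
  top-range = ≤-trans 2≤4 4≤top , top<2*top

  two-range : 2 ≤ 2 × 2 < 2 * top
  two-range = ≤-refl , <-trans (<-≤-trans 2<4 4≤top) top<2*top

  doubled-range : InRange (suc (suc (suc n))) (map (2 *_) xs)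
  doubled-range = All.map (λ (4≤r , r<top) → ≤-trans 2≤4 4≤r , <-trans r<top top<2*top) doubled

  two-fresh : 2 ∉ map (2 *_) xs
  two-fresh 2∈ with (4≤2 , _) ← All.lookup doubled 2∈ = <⇒≱ 2<4 4≤2

  top-fresh : top ∉ 2 ∷ map (2 *_) xs
  top-fresh (here top≡2)  = <⇒≢ (<-≤-trans 2<4 4≤top) (sym top≡2)
  top-fresh (there top∈) = <-irrefl refl (proj₂ (All.lookup doubled top∈))

pair-repeated : ∀ x → ExactlyOneRepeated (x ∷ x ∷ [])
pair-repeated x = x , multiplicity-pair , others
  where
  multiplicity-pair : multiplicity x (x ∷ x ∷ []) ≡ 2
  multiplicity-pair = trans (multiplicity-head x _) (cong suc (multiplicity-head x []))

  others : (y : ℕ) → y ≢ x → multiplicity y (x ∷ x ∷ []) ≤ 1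
  others y y≢x = subst (_≤ 1) (sym (multiplicity-∉ (x ∷ x ∷ []) y∉)) z≤n
    where
    y∉ : y ∉ x ∷ x ∷ []
    y∉ (here y≡x)         = y≢x y≡x
    y∉ (there (here y≡x)) = y≢x y≡x

labelling-repeated : ∀ k → let xs = ρ-values (labelling k) in
                     InRange (suc (suc k)) xs × ExactlyOneRepeated xs
labelling-repeated zero =
  (≤-refl , 2<4) ∷ (≤-refl , 2<4) ∷ [] , pair-repeated 2
labelling-repeated (suc zero) =
  (2≤4 , 4<8) ∷ (≤-refl , 2<8) ∷ (≤-refl , 2<8) ∷ [] ,
  exactlyOneRepeated-∷ 4∉ (pair-repeated 2)
  where
  4<8 : 4 < 8
  4<8 = s≤s (s≤s (s≤s (s≤s (s≤s z≤n))))

  2<8 : 2 < 8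
  2<8 = s≤s (s≤s (s≤s z≤n))

  4∉ : 4 ∉ 2 ∷ 2 ∷ []
  4∉ (here ())
  4∉ (there (here ()))
labelling-repeated (suc (suc k)) =
  subst (λ xs → InRange (suc (suc (suc (suc k)))) xs × ExactlyOneRepeated xs)
        (sym (ρ-values-apex-two-one (labelling k)))
        (uncurry (doubling-step (suc k)) (labelling-repeated k))

theorem4p2 : (n : ℕ) → n ≥ 2 →
    Σ (TwoLabelling n) λ ℓ → Σ ℕ λ x →
      (classSize ℓ x ≡ 2) × ((y : ℕ) → ¬ (y ≡ x) → classSize ℓ y ≤ 1)
theorem4p2 (suc zero) (s≤s ())
theorem4p2 (suc (suc k)) _ with _ , (x , twice , others) ← labelling-repeated k =
  labelling k , x ,
  trans (classSize≡multiplicity (labelling k) x) twice ,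
  λ y y≢x → subst (_≤ 1) (sym (classSize≡multiplicity (labelling k) y)) (others y y≢x)
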